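{- Let $n\ge 1$ be an integer and let $\mathcal F\subset\binom{[n]}{3}$ be shifted and have property $U(3,7)$, i.e. $|F_1\cup F_2\cup F_3|\le 7$ for all $F_1,F_2,F_3\in\mathcal F$. Let $\mathcal F_1:=\mathcal A(1,1,n,3)$, $\mathcal F_2:=\mathcal A(4,2,n,3)$, $\mathcal F_3:=\mathcal A(7,3,n,3)$. Then $|\mathcal F|<\max_{i\in[3]}|\mathcal F_i|$, unless $\mathcal F\in\{\mathcal F_1,\mathcal F_2,\mathcal F_3\}$.
   Context: For integers $p\ge r\ge 0$, $\mathcal A(p,r,n,k):=\{A\in\binom{[n]}{k}:|A\cap[p]|\ge r\}$. For $F=\{a_1<\ldots<a_k\}$ and $G=\{b_1<\ldots<b_k\}$ write $G\prec_s F$ if $b_j\le a_j$ for all $j$. A family $\mathcal F\subset\binom{[n]}{k}$ is shifted if $F\in\mathcal F$ and $G\prec_s F$ imply $G\in\mathcal F$. The sets $F_i$ need not be distinct. -}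

module Defs where

open import Data.Nat using (ℕ; zero; suc; _+_; _∸_; _≤_; _<_; _≤ᵇ_; _≟_)
open import Data.Bool using (Bool; true; false; if_then_else_; T?)
open import Data.Product using (_×_; _,_)
open import Data.List using (List; []; _∷_; _++_; map; concatMap; upTo; length; filter; deduplicate)
open import Relation.Binary.PropositionalEquality using (_≡_)

-- A 3-subset {a<b<c} of [n] = {1,…,n} is represented by the sorted triple (a , b , c).
Triple : Set
Triple = ℕ × ℕ × ℕ

Valid : ℕ → Triple → Set
Valid n (a , b , c) = (1 ≤ a) × (a < b) × (b < c) × (c ≤ n)

range1 : ℕ → List ℕ
range1 k = map suc (upTo k)

triples : ℕ → List Triple
triples n = concatMap (λ c → concatMap (λ b → map (λ a → (a , b , c)) (range1 (b ∸ 1)))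
                                         (range1 (c ∸ 1)))
                      (range1 n)

-- a family F ⊆ binom([n],3), given by its (decidable) membership on valid triples;
-- values on non-valid triples are irrelevant everywhere below.
Family : Set
Family = Triple → Bool

card : ℕ → Family → ℕ
card n F = length (filter (λ t → T? (F t)) (triples n))

SameFamily : ℕ → Family → Family → Set
SameFamily n F G = ∀ t → Valid n t → F t ≡ G t

_≺ₛ_ : Triple → Triple → Set
(b₁ , b₂ , b₃) ≺ₛ (a₁ , a₂ , a₃) = (b₁ ≤ a₁) × (b₂ ≤ a₂) × (b₃ ≤ a₃)

Shifted : ℕ → Family → Set
Shifted n F = ∀ f g → Valid n f → Valid n g → g ≺ₛ f → F f ≡ true → F g ≡ true

elems : Triple → List ℕ
elems (a , b , c) = a ∷ b ∷ c ∷ []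

unionSize : Triple → Triple → Triple → ℕ
unionSize t₁ t₂ t₃ = length (deduplicate _≟_ (elems t₁ ++ elems t₂ ++ elems t₃))

U37 : ℕ → Family → Set
U37 n F = ∀ t₁ t₂ t₃ → Valid n t₁ → Valid n t₂ → Valid n t₃ →
          F t₁ ≡ true → F t₂ ≡ true → F t₃ ≡ true → unionSize t₁ t₂ t₃ ≤ 7

A : ℕ → ℕ → Family
A p r (a , b , c) = r ≤ᵇ (ind a + ind b + ind c)
  where
  ind : ℕ → ℕ
  ind x = if x ≤ᵇ p then 1 else 0

module Submission where

-- If a shifted F with property U(3,7) is contained in one of the three
-- extremal families but differs from it, it is strictly smaller.  Otherwise F
-- has a member outside each of them, and shifting these members down puts
-- (2,3,4), (1,5,6) and (1,2,8) into F (so n ≥ 8).  Property U(3,7) then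
-- excludes (1,7,8) and (3,4,7), and a case distinction on (1,3,8) and (1,6,7)
-- excludes further triples.  A shifted family missing every triple of a list L
-- lies inside Avoid L, the family of triples dominating no member of L.

open import Defs
open import Data.Nat using (ℕ; zero; suc; _+_; _∸_; _≤_; _<_; _⊔_; z≤n; s≤s; _≤ᵇ_; _<ᵇ_; _≤?_; _<?_; _≤′_; ≤′-refl; ≤′-step)
open import Data.Nat.Properties
open import Data.Bool using (Bool; true; false; T; T?; not; _∧_)
open import Data.Bool.Properties using (T-≡; T-∧; ¬-not) renaming (_≟_ to _≟ᵇ_)
open import Data.Product using (∃; _×_; _,_)
open import Data.Sum using (_⊎_; inj₁; inj₂)
open import Data.List using (List; []; _∷_; [_]; _++_; map; concat; concatMap; upTo; length; filter)
open import Data.List.Properties using (map-++; concat-++; ++-identityʳ; upTo-∷ʳ; length-++; filter-++)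
open import Data.List.Relation.Unary.All using (All; []; _∷_; all?)
open import Data.List.Relation.Unary.Any using (here; there; any?)
open import Data.List.Membership.Propositional using (_∈_; find; lose)
open import Data.List.Membership.Propositional.Properties using (∈-map⁺; ∈-map⁻; ∈-concatMap⁺; ∈-concatMap⁻; ∈-upTo⁺; ∈-upTo⁻)
open import Function.Bundles using (Equivalence)
open import Relation.Binary.PropositionalEquality using (_≡_; refl; sym; trans; cong; cong₂; subst; module ≡-Reasoning)
open import Relation.Nullary using (¬_; Dec; yes; no)
open import Relation.Nullary.Decidable using (True; toWitness; _×-dec_)
open import Data.Empty using (⊥-elim)

≤ᵇ-true : ∀ {m n} → m ≤ n → (m ≤ᵇ n) ≡ true
≤ᵇ-true p = Equivalence.to T-≡ (≤⇒≤ᵇ p)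

cnt : Family → List Triple → ℕ
cnt P l = length (filter (λ t → T? (P t)) l)

cnt-++ : ∀ P xs ys → cnt P (xs ++ ys) ≡ cnt P xs + cnt P ys
cnt-++ P xs ys = trans (cong length (filter-++ (λ t → T? (P t)) xs ys)) (length-++ (filter _ xs))

cnt-mono : ∀ (P Q : Family) l → (∀ t → t ∈ l → P t ≡ true → Q t ≡ true) → cnt P l ≤ cnt Q l
cnt-mono P Q [] P⊆Q = z≤n
cnt-mono P Q (x ∷ l) P⊆Q with P x in Px | Q x in Qx
... | true  | true  = s≤s (cnt-mono P Q l (λ t t∈ → P⊆Q t (there t∈)))
... | false | true  = m≤n⇒m≤1+n (cnt-mono P Q l (λ t t∈ → P⊆Q t (there t∈)))
... | false | false = cnt-mono P Q l (λ t t∈ → P⊆Q t (there t∈))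
... | true  | false with () ← trans (sym (P⊆Q x (here refl) Px)) Qx

cnt-strict : ∀ (P Q : Family) l → (∀ t → t ∈ l → P t ≡ true → Q t ≡ true) →
             ∀ {t} → t ∈ l → Q t ≡ true → P t ≡ false → cnt P l < cnt Q l
cnt-strict P Q (x ∷ l) P⊆Q (here refl) Qx Px rewrite Qx | Px =
  s≤s (cnt-mono P Q l (λ t t∈ → P⊆Q t (there t∈)))
cnt-strict P Q (x ∷ l) P⊆Q (there t∈l) Qt Pt with P x in Px | Q x in Qx
... | true  | true  = s≤s (cnt-strict P Q l (λ t t∈ → P⊆Q t (there t∈)) t∈l Qt Pt)
... | false | true  = m≤n⇒m≤1+n (cnt-strict P Q l (λ t t∈ → P⊆Q t (there t∈)) t∈l Qt Pt)
... | false | false = cnt-strict P Q l (λ t t∈ → P⊆Q t (there t∈)) t∈l Qt Pt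
... | true  | false with () ← trans (sym (P⊆Q x (here refl) Px)) Qx

-- The enumeration: row c b lists the triples (a,b,c), layer c those with maximum c,
-- so that triples n = concatMap layer (range1 n).
row : ℕ → ℕ → List Triple
row c b = map (λ a → (a , b , c)) (range1 (b ∸ 1))

layerOver : ℕ → List ℕ → List Triple
layerOver c bs = concatMap (row c) bs

layer : ℕ → List Triple
layer c = layerOver c (range1 (c ∸ 1))

range1-suc : ∀ k → range1 (suc k) ≡ range1 k ++ [ suc k ]
range1-suc k = trans (cong (map suc) (sym (upTo-∷ʳ k))) (map-++ suc (upTo k) [ k ])

cnt-concatMap-last : ∀ P (f : ℕ → List Triple) k →
  cnt P (concatMap f (range1 (suc k))) ≡ cnt P (concatMap f (range1 k)) + cnt P (f (suc k))
cnt-concatMap-last P f k = begin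
  cnt P (concatMap f (range1 (suc k)))
    ≡⟨ cong (λ l → cnt P (concatMap f l)) (range1-suc k) ⟩
  cnt P (concat (map f (range1 k ++ [ suc k ])))
    ≡⟨ cong (λ l → cnt P (concat l)) (map-++ f (range1 k) [ suc k ]) ⟩
  cnt P (concat (map f (range1 k) ++ [ f (suc k) ]))
    ≡⟨ cong (cnt P) (sym (concat-++ (map f (range1 k)) [ f (suc k) ])) ⟩
  cnt P (concatMap f (range1 k) ++ (f (suc k) ++ []))
    ≡⟨ cnt-++ P (concatMap f (range1 k)) _ ⟩
  cnt P (concatMap f (range1 k)) + cnt P (f (suc k) ++ [])
    ≡⟨ cong (λ l → cnt P (concatMap f (range1 k)) + cnt P l) (++-identityʳ (f (suc k))) ⟩
  cnt P (concatMap f (range1 k)) + cnt P (f (suc k)) ∎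
  where open ≡-Reasoning

card-suc : ∀ n F → card (suc n) F ≡ card n F + cnt F (layer (suc n))
card-suc n F = cnt-concatMap-last F layer n

layer-split : ∀ P c → cnt P (layer (suc (suc c))) ≡ cnt P (layerOver (suc (suc c)) (range1 c)) + cnt P (row (suc (suc c)) (suc c))
layer-split P c = cnt-concatMap-last P (row (suc (suc c))) c

cnt-map-cong : ∀ P (f g : ℕ → Triple) xs → (∀ x → P (f x) ≡ P (g x)) → cnt P (map f xs) ≡ cnt P (map g xs)
cnt-map-cong P f g [] f≈g = refl
cnt-map-cong P f g (x ∷ xs) f≈g with P (f x) | P (g x) | f≈g x
... | true  | true  | refl = cong suc (cnt-map-cong P f g xs f≈g)
... | false | false | refl = cnt-map-cong P f g xs f≈g

cnt-layerOver-move : ∀ P c c' bs → (∀ a b → P (a , b , c) ≡ P (a , b , c')) →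
  cnt P (layerOver c bs) ≡ cnt P (layerOver c' bs)
cnt-layerOver-move P c c' [] P≈ = refl
cnt-layerOver-move P c c' (b ∷ bs) P≈ = begin
  cnt P (row c b ++ layerOver c bs)          ≡⟨ cnt-++ P (row c b) _ ⟩
  cnt P (row c b) + cnt P (layerOver c bs)   ≡⟨ cong₂ _+_ (cnt-map-cong P _ _ (range1 (b ∸ 1)) (λ a → P≈ a b))
                                                          (cnt-layerOver-move P c c' bs P≈) ⟩
  cnt P (row c' b) + cnt P (layerOver c' bs) ≡⟨ sym (cnt-++ P (row c' b) _) ⟩
  cnt P (row c' b ++ layerOver c' bs) ∎
  where open ≡-Reasoning

cnt-row-empty : ∀ P b c xs → (∀ a → P (suc a , b , c) ≡ false) → cnt P (map (λ a → (a , b , c)) (map suc xs)) ≡ 0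
cnt-row-empty P b c [] empty = refl
cnt-row-empty P b c (x ∷ xs) empty rewrite empty x = cnt-row-empty P b c xs empty

layer-stable : ∀ P c → (∀ a b → P (a , b , suc (suc c)) ≡ P (a , b , suc c)) →
  (∀ a → P (suc a , suc c , suc (suc c)) ≡ false) →
  cnt P (layer (suc (suc c))) ≡ cnt P (layer (suc c))
layer-stable P c P≈ empty = begin
  cnt P (layer (suc (suc c)))
    ≡⟨ layer-split P c ⟩
  cnt P (layerOver (suc (suc c)) (range1 c)) + cnt P (row (suc (suc c)) (suc c))
    ≡⟨ cong₂ _+_ (cnt-layerOver-move P _ _ (range1 c) P≈) (cnt-row-empty P (suc c) (suc (suc c)) (upTo c) empty) ⟩
  cnt P (layer (suc c)) + 0
    ≡⟨ +-identityʳ _ ⟩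
  cnt P (layer (suc c)) ∎
  where open ≡-Reasoning

layer-mono : ∀ P c → (∀ a b → P (a , b , suc (suc c)) ≡ P (a , b , suc c)) →
  cnt P (layer (suc c)) ≤ cnt P (layer (suc (suc c)))
layer-mono P c P≈ = begin
  cnt P (layer (suc c))
    ≡⟨ sym (cnt-layerOver-move P _ _ (range1 c) P≈) ⟩
  cnt P (layerOver (suc (suc c)) (range1 c))
    ≤⟨ m≤m+n _ _ ⟩
  cnt P (layerOver (suc (suc c)) (range1 c)) + cnt P (row (suc (suc c)) (suc c))
    ≡⟨ sym (layer-split P c) ⟩
  cnt P (layer (suc (suc c))) ∎
  where open ≤-Reasoning

card-tail : ∀ (G H : Family) n₀ → card n₀ G < card n₀ H →
  (∀ c → n₀ < c → cnt G (layer c) ≤ cnt H (layer c)) → ∀ n → n₀ ≤ n → card n G < card n H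
card-tail G H n₀ base layers n n₀≤n = ahead (≤⇒≤′ n₀≤n)
  where
  ahead : ∀ {n} → n₀ ≤′ n → card n G < card n H
  ahead ≤′-refl = base
  ahead (≤′-step {n} p) = begin-strict
    card (suc n) G                    ≡⟨ card-suc n G ⟩
    card n G + cnt G (layer (suc n))  <⟨ +-mono-<-≤ (ahead p) (layers (suc n) (s≤s (≤′⇒≤ p))) ⟩
    card n H + cnt H (layer (suc n))  ≡⟨ sym (card-suc n H) ⟩
    card (suc n) H ∎
    where open ≤-Reasoning

∈-range1⁻ : ∀ {k x} → x ∈ range1 k → 1 ≤ x × x ≤ k
∈-range1⁻ p with _ , y∈ , refl ← ∈-map⁻ suc p = s≤s z≤n , ∈-upTo⁻ y∈

∈-range1⁺ : ∀ {k x} → 1 ≤ x → x ≤ k → x ∈ range1 k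
∈-range1⁺ {x = suc y} _ x≤k = ∈-map⁺ suc (∈-upTo⁺ x≤k)

<⇒≤∸1 : ∀ {x y} → x < y → x ≤ y ∸ 1
<⇒≤∸1 (s≤s p) = p

≤∸1⇒< : ∀ {x y} → 1 ≤ y → x ≤ y ∸ 1 → x < y
≤∸1⇒< {y = suc y} _ p = s≤s p

sound : ∀ n {t} → t ∈ triples n → Valid n t
sound n t∈
  with c , c∈ , t∈layer ← find (∈-concatMap⁻ layer {xs = range1 n} t∈)
  with b , b∈ , t∈row ← find (∈-concatMap⁻ (row c) {xs = range1 (c ∸ 1)} t∈layer)
  with a , a∈ , refl ← ∈-map⁻ (λ a → (a , b , c)) t∈row
  with 1≤c , c≤n ← ∈-range1⁻ c∈
  with 1≤b , b≤ ← ∈-range1⁻ b∈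
  with 1≤a , a≤ ← ∈-range1⁻ a∈
  = 1≤a , ≤∸1⇒< 1≤b a≤ , ≤∸1⇒< 1≤c b≤ , c≤n

complete : ∀ n {t} → Valid n t → t ∈ triples n
complete n {a , b , c} (1≤a , a<b , b<c , c≤n) =
  ∈-concatMap⁺ layer (lose (∈-range1⁺ 1≤c c≤n)
    (∈-concatMap⁺ (row c) (lose (∈-range1⁺ 1≤b (<⇒≤∸1 b<c))
      (∈-map⁺ (λ a → (a , b , c)) (∈-range1⁺ 1≤a (<⇒≤∸1 a<b))))))
  where
  1≤b = ≤-trans 1≤a (<⇒≤ a<b)
  1≤c = ≤-trans 1≤b (<⇒≤ b<c)

_⊆[_]_ : Family → ℕ → Family → Set
F ⊆[ n ] G = ∀ t → Valid n t → F t ≡ true → G t ≡ true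

Outside : ℕ → Family → Family → Set
Outside n F G = ∃ λ t → Valid n t × F t ≡ true × G t ≡ false

card-mono : ∀ n {F G} → F ⊆[ n ] G → card n F ≤ card n G
card-mono n {F} {G} F⊆G = cnt-mono F G (triples n) (λ t t∈ → F⊆G t (sound n t∈))

inclusion-or-witness : ∀ n F G → F ⊆[ n ] G ⊎ Outside n F G
inclusion-or-witness n F G with any? (λ t → (F t ≟ᵇ true) ×-dec (G t ≟ᵇ false)) (triples n)
... | yes w = let t , t∈ , Ft , Gt = find w in inj₂ (t , sound n t∈ , Ft , Gt)
... | no ¬w = inj₁ λ t v Ft → ¬-not (λ Gt → ¬w (lose (complete n v) (Ft , Gt)))

bool-antisym : ∀ {x y} → (x ≡ true → y ≡ true) → (y ≡ true → x ≡ true) → x ≡ y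
bool-antisym {false} {false} _ _ = refl
bool-antisym {false} {true}  _ y⇒x = y⇒x refl
bool-antisym {true}  {_}     x⇒y _ = sym (x⇒y refl)

proper-subfamily : ∀ n {F G} → F ⊆[ n ] G → ¬ SameFamily n F G → card n F < card n G
proper-subfamily n {F} {G} F⊆G F≢G with inclusion-or-witness n G F
... | inj₂ (t , v , Gt , Ft) = cnt-strict F G (triples n) (λ t t∈ → F⊆G t (sound n t∈)) (complete n v) Gt Ft
... | inj₁ G⊆F = ⊥-elim (F≢G (λ t v → bool-antisym (F⊆G t v) (G⊆F t v)))

_≼ᵇ_ : Triple → Triple → Bool
(b₁ , b₂ , b₃) ≼ᵇ (a₁ , a₂ , a₃) = (b₁ ≤ᵇ a₁) ∧ (b₂ ≤ᵇ a₂) ∧ (b₃ ≤ᵇ a₃)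

≼ᵇ-sound : ∀ g f → T (g ≼ᵇ f) → g ≺ₛ f
≼ᵇ-sound (b₁ , b₂ , b₃) (a₁ , a₂ , a₃) h =
  let p , qr = Equivalence.to T-∧ h
      q , r  = Equivalence.to T-∧ qr
  in ≤ᵇ⇒≤ b₁ a₁ p , ≤ᵇ⇒≤ b₂ a₂ q , ≤ᵇ⇒≤ b₃ a₃ r

Avoid : List Triple → Family
Avoid []      t = true
Avoid (f ∷ L) t = not (f ≼ᵇ t) ∧ Avoid L t

Missing : ℕ → Family → Triple → Set
Missing n F f = Valid n f × F f ≡ false

shifted⊆Avoid : ∀ n F L → Shifted n F → All (Missing n F) L → F ⊆[ n ] Avoid L
shifted⊆Avoid n F [] sh [] t vt Ft = refl
shifted⊆Avoid n F (f ∷ L) sh ((vf , Ff) ∷ miss) t vt Ft with f ≼ᵇ t in f≼t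
... | true with () ← trans (sym (sh t f vt vf (≼ᵇ-sound f t (Equivalence.from T-≡ f≼t)) Ft)) Ff
... | false = shifted⊆Avoid n F L sh miss t vt Ft

largest : Triple → ℕ
largest (_ , _ , c) = c

Avoid-ignores-max : ∀ d L → All (λ f → largest f ≤ d) L → ∀ a b {c c'} → d ≤ c → d ≤ c' →
  Avoid L (a , b , c) ≡ Avoid L (a , b , c')
Avoid-ignores-max d [] _ a b _ _ = refl
Avoid-ignores-max d ((f₁ , f₂ , f₃) ∷ L) (f₃≤d ∷ tops) a b d≤c d≤c'
  rewrite ≤ᵇ-true (≤-trans f₃≤d d≤c) | ≤ᵇ-true (≤-trans f₃≤d d≤c')
        | Avoid-ignores-max d L tops a b d≤c d≤c' = refl

Avoid-row-empty : ∀ b₀ c₀ L a {b c} → b₀ ≤ b → c₀ ≤ c → Avoid ((1 , b₀ , c₀) ∷ L) (suc a , b , c) ≡ false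
Avoid-row-empty b₀ c₀ L a b₀≤b c₀≤c rewrite ≤ᵇ-true b₀≤b | ≤ᵇ-true c₀≤c = refl

Avoid-layer-constant : ∀ L → All (λ f → largest f ≤ 8) ((1 , 7 , 8) ∷ L) → ∀ k →
  cnt (Avoid ((1 , 7 , 8) ∷ L)) (layer (8 + k)) ≡ cnt (Avoid ((1 , 7 , 8) ∷ L)) (layer 8)
Avoid-layer-constant L tops zero = refl
Avoid-layer-constant L tops (suc k) = trans
  (layer-stable (Avoid ((1 , 7 , 8) ∷ L)) (7 + k)
    (λ a b → Avoid-ignores-max 8 _ tops a b (m≤m+n 8 (suc k)) (m≤m+n 8 k))
    (λ a → Avoid-row-empty 7 8 L a (m≤m+n 7 (suc k)) (m≤m+n 8 (suc k))))
  (Avoid-layer-constant L tops k)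

A11-layer : ∀ k → 6 ≤ cnt (A 1 1) (layer (8 + k))
A11-layer zero = ≤ᵇ⇒≤ 6 _ _
A11-layer (suc k) = ≤-trans (A11-layer k) (layer-mono (A 1 1) (7 + k) (λ a b → refl))

M : ℕ → ℕ
M n = card n (A 1 1) ⊔ card n (A 4 2) ⊔ card n (A 7 3)

≤M₁ : ∀ n → card n (A 1 1) ≤ M n
≤M₁ n = ≤-trans (m≤m⊔n _ _) (m≤m⊔n _ _)

≤M₂ : ∀ n → card n (A 4 2) ≤ M n
≤M₂ n = ≤-trans (m≤n⊔m (card n (A 1 1)) _) (m≤m⊔n _ _)

≤M₃ : ∀ n → card n (A 7 3) ≤ M n
≤M₃ n = m≤n⊔m _ _

-- The finitely many facts about G = Avoid ((1,7,8) ∷ L) that are checked by evaluation.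
SmallCases : List Triple → Set
SmallCases L =
  All (λ f → largest f ≤ 8) ((1 , 7 , 8) ∷ L) ×
  All (λ n → card n (Avoid ((1 , 7 , 8) ∷ L)) < M n) (8 ∷ 9 ∷ 10 ∷ 11 ∷ 12 ∷ []) ×
  card 13 (Avoid ((1 , 7 , 8) ∷ L)) < card 13 (A 1 1) ×
  cnt (Avoid ((1 , 7 , 8) ∷ L)) (layer 8) ≤ 6

small-cases? : ∀ L → Dec (SmallCases L)
small-cases? L =
  all? (λ f → largest f ≤? 8) _ ×-dec
  all? (λ n → card n (Avoid ((1 , 7 , 8) ∷ L)) <? M n) _ ×-dec
  (card 13 (Avoid ((1 , 7 , 8) ∷ L)) <? card 13 (A 1 1)) ×-dec
  (cnt (Avoid ((1 , 7 , 8) ∷ L)) (layer 8) ≤? 6)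

Avoid-below-M : ∀ L → SmallCases L → ∀ n → 8 ≤ n → card n (Avoid ((1 , 7 , 8) ∷ L)) < M n
Avoid-below-M L (tops , (c8 ∷ c9 ∷ c10 ∷ c11 ∷ c12 ∷ []) , c13 , layer8) n 8≤n =
  subst (λ n → card n G < M n) (m+[n∸m]≡n 8≤n) (from8 (n ∸ 8))
  where
  G = Avoid ((1 , 7 , 8) ∷ L)

  thin-layers : ∀ c → 13 < c → cnt G (layer c) ≤ cnt (A 1 1) (layer c)
  thin-layers c 13<c = subst (λ c → cnt G (layer c) ≤ cnt (A 1 1) (layer c)) (m+[n∸m]≡n 8≤c)
    (≤-trans (≤-reflexive (Avoid-layer-constant L tops (c ∸ 8))) (≤-trans layer8 (A11-layer (c ∸ 8))))
    where 8≤c = ≤-trans (≤ᵇ⇒≤ 8 13 _) (<⇒≤ 13<c)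

  from8 : ∀ k → card (8 + k) G < M (8 + k)
  from8 0 = c8
  from8 1 = c9
  from8 2 = c10
  from8 3 = c11
  from8 4 = c12
  from8 (suc (suc (suc (suc (suc k))))) =
    <-≤-trans (card-tail G (A 1 1) 13 c13 thin-layers (13 + k) (m≤m+n 13 k)) (≤M₁ (13 + k))

valid : ∀ {n} a b c → {T (1 ≤ᵇ a)} → {T (a <ᵇ b)} → {T (b <ᵇ c)} → c ≤ n → Valid n (a , b , c)
valid a b c {p} {q} {r} c≤n = ≤ᵇ⇒≤ 1 a p , <ᵇ⇒< a b q , <ᵇ⇒< b c r , c≤n

A42-true : ∀ {a b} c → a ≤ 4 → b ≤ 4 → A 4 2 (a , b , c) ≡ true
A42-true c a≤4 b≤4 rewrite ≤ᵇ-true a≤4 | ≤ᵇ-true b≤4 = refl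

A73-true : ∀ {a b c} → a ≤ 7 → b ≤ 7 → c ≤ 7 → A 7 3 (a , b , c) ≡ true
A73-true a≤7 b≤7 c≤7 rewrite ≤ᵇ-true a≤7 | ≤ᵇ-true b≤7 | ≤ᵇ-true c≤7 = refl

module Outliers (n : ℕ) (F : Family) (sh : Shifted n F) where

  -- Outside A(1,1) the least element is ≥ 2, so (2,3,4) ∈ F.
  outside-A11 : Outside n F (A 1 1) → F (2 , 3 , 4) ≡ true
  outside-A11 ((suc zero , b , c) , _ , _ , ())
  outside-A11 ((suc (suc a) , b , c) , v@(1≤a , a<b , b<c , c≤n) , Ft , _) =
    sh _ _ v (valid 2 3 4 (≤-trans 4≤c c≤n)) (s≤s (s≤s z≤n) , 3≤b , 4≤c) Ft
    where
    3≤b = ≤-trans (s≤s (s≤s (s≤s z≤n))) a<b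
    4≤c = ≤-trans (s≤s 3≤b) b<c

  -- Outside A(4,2) the middle element is ≥ 5, so (1,5,6) ∈ F.
  outside-A42 : Outside n F (A 4 2) → F (1 , 5 , 6) ≡ true
  outside-A42 ((a , b , c) , v@(1≤a , a<b , b<c , c≤n) , Ft , At) with b ≤? 4
  ... | yes b≤4 with () ← trans (sym (A42-true c (≤-trans (<⇒≤ a<b) b≤4) b≤4)) At
  ... | no b≰4 = sh _ _ v (valid 1 5 6 (≤-trans 6≤c c≤n)) (1≤a , 5≤b , 6≤c) Ft
    where
    5≤b = ≰⇒> b≰4
    6≤c = ≤-trans (s≤s 5≤b) b<c

  -- Outside A(7,3) the largest element is ≥ 8, so (1,2,8) ∈ F and n ≥ 8.
  outside-A73 : Outside n F (A 7 3) → F (1 , 2 , 8) ≡ true × 8 ≤ n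
  outside-A73 ((a , b , c) , v@(1≤a , a<b , b<c , c≤n) , Ft , At) with c ≤? 7
  ... | yes c≤7
    with b≤7 ← ≤-trans (<⇒≤ b<c) c≤7
    with () ← trans (sym (A73-true (≤-trans (<⇒≤ a<b) b≤7) b≤7 c≤7)) At
  ... | no c≰7 = sh _ _ v (valid 1 2 8 (≤-trans 8≤c c≤n)) (1≤a , ≤-trans (s≤s 1≤a) a<b , 8≤c) Ft , ≤-trans 8≤c c≤n
    where 8≤c = ≰⇒> c≰7

module AllOutside (n : ℕ) (F : Family) (8≤n : 8 ≤ n) (sh : Shifted n F) (u : U37 n F)
                  (F234 : F (2 , 3 , 4) ≡ true) (F156 : F (1 , 5 , 6) ≡ true) (F128 : F (1 , 2 , 8) ≡ true) where

  v : ∀ a b c → {T (1 ≤ᵇ a)} → {T (a <ᵇ b)} → {T (b <ᵇ c)} → {T (c ≤ᵇ 8)} → Valid n (a , b , c)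
  v a b c {p} {q} {r} {s} = valid a b c {p} {q} {r} (≤-trans (≤ᵇ⇒≤ c 8 s) 8≤n)

  excluded : ∀ f t₁ t₂ → Valid n f → Valid n t₁ → Valid n t₂ → F t₁ ≡ true → F t₂ ≡ true →
             {T (7 <ᵇ unionSize f t₁ t₂)} → Missing n F f
  excluded f t₁ t₂ vf v₁ v₂ F₁ F₂ {big} with F f in Ff
  ... | false = vf , refl
  ... | true  = ⊥-elim (<⇒≱ (<ᵇ⇒< 7 _ big) (u f t₁ t₂ vf v₁ v₂ Ff F₁ F₂))

  avoiding : ∀ L → {True (small-cases? L)} → All (Missing n F) L → card n F < M n
  avoiding L {ok} miss = ≤-<-trans
    (card-mono n (shifted⊆Avoid n F _ sh (missing178 ∷ miss)))
    (Avoid-below-M L (toWitness ok) n 8≤n)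
    where missing178 = excluded (1 , 7 , 8) (2 , 3 , 4) (1 , 5 , 6) (v 1 7 8) (v 2 3 4) (v 1 5 6) F234 F156

  missing347 : Missing n F (3 , 4 , 7)
  missing347 = excluded (3 , 4 , 7) (1 , 5 , 6) (1 , 2 , 8) (v 3 4 7) (v 1 5 6) (v 1 2 8) F156 F128

  below-M : card n F < M n
  below-M with F (1 , 3 , 8) in F138
  ... | false = avoiding ((3 , 4 , 7) ∷ (1 , 3 , 8) ∷ []) (missing347 ∷ (v 1 3 8 , F138) ∷ [])
  ... | true with F (1 , 6 , 7) in F167
  ...   | true = avoiding ((3 , 4 , 7) ∷ (2 , 4 , 7) ∷ (2 , 4 , 5) ∷ [])
                   (missing347 ∷ missing247 ∷ excluded _ _ _ (v 2 4 5) (v 1 6 7) (v 1 3 8) F167 F138 ∷ [])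
    where missing247 = excluded (2 , 4 , 7) (1 , 3 , 8) (1 , 5 , 6) (v 2 4 7) (v 1 3 8) (v 1 5 6) F138 F156
  ...   | false = avoiding ((3 , 4 , 7) ∷ (2 , 4 , 7) ∷ (1 , 6 , 7) ∷ (4 , 5 , 6) ∷ [])
                   (missing347 ∷ missing247 ∷ (v 1 6 7 , F167) ∷ excluded _ _ _ (v 4 5 6) (v 1 2 7) (v 1 3 8) F127 F138 ∷ [])
    where
    missing247 = excluded (2 , 4 , 7) (1 , 3 , 8) (1 , 5 , 6) (v 2 4 7) (v 1 3 8) (v 1 5 6) F138 F156
    F127 = sh (1 , 2 , 8) (1 , 2 , 7) (v 1 2 8) (v 1 2 7) (≼ᵇ-sound (1 , 2 , 7) (1 , 2 , 8) _) F128

theorem8 : (n : ℕ) → 1 ≤ n → (F : Family) → Shifted n F → U37 n F →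
    ¬ SameFamily n F (A 1 1) → ¬ SameFamily n F (A 4 2) → ¬ SameFamily n F (A 7 3) →
    card n F < (card n (A 1 1) ⊔ card n (A 4 2) ⊔ card n (A 7 3))
theorem8 n _ F sh u F≢A11 F≢A42 F≢A73
  with inclusion-or-witness n F (A 1 1) | inclusion-or-witness n F (A 4 2) | inclusion-or-witness n F (A 7 3)
... | inj₁ F⊆A | _ | _ = <-≤-trans (proper-subfamily n F⊆A F≢A11) (≤M₁ n)
... | inj₂ _ | inj₁ F⊆A | _ = <-≤-trans (proper-subfamily n F⊆A F≢A42) (≤M₂ n)
... | inj₂ _ | inj₂ _ | inj₁ F⊆A = <-≤-trans (proper-subfamily n F⊆A F≢A73) (≤M₃ n)
... | inj₂ out₁ | inj₂ out₂ | inj₂ out₃ =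
  let open Outliers n F sh
      F128 , 8≤n = outside-A73 out₃
  in AllOutside.below-M n F 8≤n sh u (outside-A11 out₁) (outside-A42 out₂) F128
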